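{- The hyper conversion procedure terminates on every closed clausal tableau given as input.
   Context: A clausal tableau for a clausal formula $F$ is a finite ordered tree whose non-root nodes $N$ carry a literal label $\mathrm{lit}(N)$ such that for each node the disjunction of the literals of its children is an instance of a clause of $F$ (the root has no literal label). A branch is closed if it contains complementary literals; a tableau is closed if all branches are; a node is closing if it has an ancestor with complementary literal. A tableau is regular if no node has an ancestor with the same literal, and leaf-closing if all closing nodes are leaves. Simplification to leaf-closing and regular form: repeatedly select a node $N$ with an ancestor having the same literal, remove the edges originating in the parent of $N$ and replace them by the edges originating in $N$; and repeatedly select an inner closing node and remove the edges originating in it. A fresh copy of an ordered tree is an isomorphic tree with new nodes and edges and the same labels. The hyper conversion procedure: given a closed clausal tableau, simplify it to leaf-closing and regular form, then repeat the following until every node with a negative literal label is a leaf: (1) let $N'$ be the first node in pre-order having a child that is an inner node with a negative literal label, and let $N$ be the leftmost such child; (2) create a fresh copy $U$ of the subtree rooted at $N'$ and in $U$ remove the edges originating in the node corresponding to $N$; (3) replace the edges originating in $N'$ with the edges originating in $N$; (4) for each leaf descendant $M$ of $N'$ with $\mathrm{lit}(M)$ the complement of $\mathrm{lit}(N)$, create a fresh copy $U'$ of $U$ and change the origin of the edges originating in the root of $U'$ to $M$; (5) simplify the tableau to leaf-closing and regular form. -}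

module Defs where

open import Data.Nat using (ℕ)
import Data.Nat as ℕ
open import Data.Bool using (Bool; true; false; not; if_then_else_)
import Data.Bool.Properties as BoolP
open import Data.List using (List; []; _∷_; map; _++_)
open import Data.List.Membership.Propositional using (_∈_)
open import Data.List.Relation.Binary.Permutation.Propositional using (_↭_)
open import Data.Maybe using (Maybe; just; nothing)
open import Data.Product using (∃; _×_; _,_)
open import Data.Unit using (⊤)
open import Relation.Nullary using (¬_; Dec; yes; no)
open import Relation.Nullary.Decidable using (⌊_⌋)
open import Relation.Binary.PropositionalEquality using (_≡_; refl)
open import Induction.WellFounded using (Acc)

data Term : Set where
  var : ℕ → Term
  fun : ℕ → List Term → Term

record Lit : Set where
  constructor lit
  field
    positive : Bool
    pred     : ℕ
    args     : List Term

complement : Lit → Lit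
complement (lit s p ts) = lit (not s) p ts

mutual
  _≟ₜ_ : (s t : Term) → Dec (s ≡ t)
  var x ≟ₜ var y with x ℕ.≟ y
  ... | yes refl = yes refl
  ... | no ne = no λ { refl → ne refl }
  var _ ≟ₜ fun _ _ = no λ ()
  fun _ _ ≟ₜ var _ = no λ ()
  fun f ss ≟ₜ fun g ts with f ℕ.≟ g | ss ≟ₜₛ ts
  ... | yes refl | yes refl = yes refl
  ... | no ne | _ = no λ { refl → ne refl }
  ... | yes _ | no ne = no λ { refl → ne refl }

  _≟ₜₛ_ : (ss ts : List Term) → Dec (ss ≡ ts)
  [] ≟ₜₛ [] = yes refl
  [] ≟ₜₛ (_ ∷ _) = no λ ()
  (_ ∷ _) ≟ₜₛ [] = no λ ()
  (s ∷ ss) ≟ₜₛ (t ∷ ts) with s ≟ₜ t | ss ≟ₜₛ ts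
  ... | yes refl | yes refl = yes refl
  ... | no ne | _ = no λ { refl → ne refl }
  ... | yes _ | no ne = no λ { refl → ne refl }

_≟ᴸ_ : (k l : Lit) → Dec (k ≡ l)
lit s p ss ≟ᴸ lit t q ts with s BoolP.≟ t | p ℕ.≟ q | ss ≟ₜₛ ts
... | yes refl | yes refl | yes refl = yes refl
... | no ne | _ | _ = no λ { refl → ne refl }
... | yes _ | no ne | _ = no λ { refl → ne refl }
... | yes _ | yes _ | no ne = no λ { refl → ne refl }

Subst : Set
Subst = ℕ → Term

mutual
  substT : Subst → Term → Term
  substT σ (var x) = σ x
  substT σ (fun f ts) = fun f (substTs σ ts)

  substTs : Subst → List Term → List Term
  substTs σ [] = []
  substTs σ (t ∷ ts) = substT σ t ∷ substTs σ ts

substL : Subst → Lit → Lit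
substL σ (lit s p ts) = lit s p (substTs σ ts)

-- a clause is a disjunction of literals, a clausal formula a conjunction of clauses
Clause : Set
Clause = List Lit

Formula : Set
Formula = List Clause

_IsInstanceOf_ : Clause → Clause → Set
D IsInstanceOf C = ∃ λ (σ : Subst) → map (substL σ) C ↭ D

-- Ordered trees.  A tableau is represented by the ordered list of
-- subtrees below its (unlabelled) root; every non-root node carries a literal.

data Tree : Set where
  node : Lit → List Tree → Tree

Forest : Set
Forest = List Tree

Tableau : Set
Tableau = Forest

labels : Forest → List Lit
labels [] = []
labels (node l _ ∷ ts) = l ∷ labels ts

-- clausal tableau for F: for every inner node (incl. the root if it has
-- children) the disjunction of the children's literals is an instance of a
-- clause of F.  ClausalF F cs: condition for a node with children cs and
-- all of its descendants.
mutual
  ClausalF : Formula → Forest → Set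
  ClausalF F [] = ⊤
  ClausalF F (t ∷ ts) =
    (∃ λ C → C ∈ F × labels (t ∷ ts) IsInstanceOf C) × ClausalAll F (t ∷ ts)

  ClausalAll : Formula → Forest → Set
  ClausalAll F [] = ⊤
  ClausalAll F (node l cs ∷ ts) = ClausalF F cs × ClausalAll F ts

IsClausalTableauFor : Formula → Tableau → Set
IsClausalTableauFor F T = ClausalF F T

-- closedness: every branch (maximal root-to-leaf path) contains
-- complementary literals.  br = literals on the path so far.
HasComplementaryPair : List Lit → Set
HasComplementaryPair ls = ∃ λ l → l ∈ ls × complement l ∈ ls

mutual
  ClosedF : List Lit → Forest → Set
  ClosedF br [] = HasComplementaryPair br
  ClosedF br (t ∷ ts) = ClosedAll br (t ∷ ts)

  ClosedAll : List Lit → Forest → Set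
  ClosedAll br [] = ⊤
  ClosedAll br (node l cs ∷ ts) = ClosedF (l ∷ br) cs × ClosedAll br ts

Closed : Tableau → Set
Closed T = ClosedF [] T

-- regular / leaf-closing; anc = literals of the (labelled) ancestors
RegularF : List Lit → Forest → Set
RegularF anc [] = ⊤
RegularF anc (node l cs ∷ ts) = (¬ l ∈ anc) × RegularF (l ∷ anc) cs × RegularF anc ts

LeafClosingF : List Lit → Forest → Set
LeafClosingF anc [] = ⊤
LeafClosingF anc (node l cs ∷ ts) =
  (complement l ∈ anc → cs ≡ []) × LeafClosingF (l ∷ anc) cs × LeafClosingF anc ts

Regular : Tableau → Set
Regular T = RegularF [] T

LeafClosing : Tableau → Set
LeafClosing T = LeafClosingF [] T

-- One simplification step (either kind).  SimpStep anc cs cs' : the children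
-- list cs of some node P (anc = literals of P and its ancestors) is changed to cs'.

data AtOne (R : Tree → Tree → Set) : Forest → Forest → Set where
  here  : ∀ {t t' ts} → R t t' → AtOne R (t ∷ ts) (t' ∷ ts)
  there : ∀ {t ts ts'} → AtOne R ts ts' → AtOne R (t ∷ ts) (t ∷ ts')

mutual
  data SimpStep (anc : List Lit) : Forest → Forest → Set where
    -- a child N = node l cs of P has an ancestor with literal l:
    -- the edges originating in P are replaced by those originating in N
    lift   : ∀ {f l cs} → node l cs ∈ f → l ∈ anc → SimpStep anc f cs
    inside : ∀ {f f'} → AtOne (TreeStep anc) f f' → SimpStep anc f f'

  data TreeStep (anc : List Lit) : Tree → Tree → Set where
    cut    : ∀ {l c cs} → complement l ∈ anc → TreeStep anc (node l (c ∷ cs)) (node l [])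
    deeper : ∀ {l cs cs'} → SimpStep (l ∷ anc) cs cs' → TreeStep anc (node l cs) (node l cs')

SimplificationStep : Tableau → Tableau → Set
SimplificationStep T T' = SimpStep [] T T'

innerNeg : Tree → Bool
innerNeg (node l []) = false
innerNeg (node l (_ ∷ _)) = not (Lit.positive l)

-- step (4): below N', every leaf M with literal x gets as children a fresh
-- copy of the children U of the root of U
mutual
  attach : Lit → Forest → Tree → Tree
  attach x U (node l []) = if ⌊ l ≟ᴸ x ⌋ then node l U else node l []
  attach x U (node l (c ∷ cs)) = node l (attachF x U (c ∷ cs))

  attachF : Lit → Forest → Forest → Forest
  attachF x U [] = []
  attachF x U (t ∷ ts) = attach x U t ∷ attachF x U ts

-- leftmost child that is an inner node with negative literal:
-- (siblings before, its literal, its children, siblings after)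
leftmost : Forest → Maybe (Forest × Lit × Forest × Forest)
leftmost [] = nothing
leftmost (node l ds ∷ ts) with innerNeg (node l ds)
... | true = just ([] , l , ds , ts)
... | false with leftmost ts
...   | nothing = nothing
...   | just (pre , x , es , post) = just (node l ds ∷ pre , x , es , post)

-- given the children cs of N', perform steps (2)-(4) and return the new
-- children of N' (nothing if N' has no inner child with negative literal)
hyperAt : Forest → Maybe Forest
hyperAt cs with leftmost cs
... | nothing = nothing
... | just (pre , ln , ds , post) =
  just (attachF (complement ln) (pre ++ node ln [] ∷ post) ds)

-- step (1): N' is the first node in pre-order (root first) with such a child
mutual
  search : Forest → Maybe Forest
  search cs with hyperAt cs
  ... | just cs' = just cs'
  ... | nothing = searchKids cs

  searchKids : Forest → Maybe Forest
  searchKids [] = nothing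
  searchKids (node l ds ∷ ts) with search ds
  ... | just ds' = just (node l ds' ∷ ts)
  ... | nothing with searchKids ts
  ...   | just ts' = just (node l ds ∷ ts')
  ...   | nothing = nothing

-- hyperStep T ≡ nothing  iff every node with negative literal is a leaf
hyperStep : Tableau → Maybe Tableau
hyperStep T = search T

-- The procedure as a transition system.
--   simplifying T : currently simplifying to leaf-closing and regular form
--   looping T     : at the head of the main loop

data State : Set where
  simplifying : Tableau → State
  looping     : Tableau → State

data Step : State → State → Set where
  simp     : ∀ {T T'} → SimplificationStep T T' → Step (simplifying T) (simplifying T')
  simpDone : ∀ {T} → LeafClosing T → Regular T → Step (simplifying T) (looping T)
  hyper    : ∀ {T T'} → hyperStep T ≡ just T' → Step (looping T) (simplifying T')

_◁_ : State → State → Set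
s' ◁ s = Step s s'

Terminates : State → Set
Terminates s = Acc _◁_ s

{-# OPTIONS --safe #-}
module Submission where

-- Give every inner node with a negative literal the level "number of complements
-- of initial literals that are positive and missing from the branch above it".
-- Simplification shrinks the tableau and creates no inner negative node at any
-- level.  A hyper step removes the inner negative node N at level v; the nodes
-- below N keep their levels, and the copies of N's siblings are hung only below
-- leaves labelled with the complement of N's literal.  That literal is positive
-- and, by leaf-closedness, not on the branch of N, so every new node has level
-- below v.  Hence the multiset of levels drops in the Dershowitz-Manna order,
-- and the pair (multiset of levels, size) decreases lexicographically.

open import Defs
open import Data.Bool using (true; false)
open import Data.Empty using (⊥-elim)
open import Data.List using (List; []; _∷_; _++_; length; map)
open import Data.List.Membership.Propositional using (_∈_; _∉_)
open import Data.List.Membership.Propositional.Properties using (∈-map⁺; ∈-insert)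
open import Data.List.Membership.DecPropositional _≟ᴸ_ using (_∈?_)
open import Data.List.Relation.Binary.Subset.Propositional using (_⊆_)
open import Data.List.Relation.Binary.Subset.Propositional.Properties
  using (xs⊆xs++ys; xs⊆ys++xs)
open import Data.List.Relation.Unary.Any using (here; there)
open import Data.Maybe using (just; nothing)
import Data.Maybe.Relation.Unary.All as Maybe
open import Data.Nat using (ℕ; zero; suc; _+_; _≤_; _<_; z≤n; s≤s; z<s; _≟_)
open import Data.Nat.Properties
open import Data.Nat.Induction using (<-wellFounded)
open import Data.Product using (∃-syntax; _×_; _,_; proj₁; proj₂)
open import Data.Sum using (inj₁; inj₂)
open import Data.Unit using (⊤; tt)
open import Data.Vec using (Vec; []; _∷_)
open import Data.Vec.Relation.Binary.Lex.Strict as Lex using (Lex-<; this; next)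
open import Function using (id; _∘_; case_of_)
open import Induction.WellFounded using (WellFounded; Acc; acc)
open import Relation.Nullary using (yes; no)
open import Relation.Binary.PropositionalEquality
  using (_≡_; _≢_; refl; sym; cong; cong₂; subst)

measure⇒acc : {A B : Set} {_◁_ : A → A → Set} {_⊏_ : B → B → Set} →
              WellFounded _⊏_ → (μ : A → B) (Inv : A → Set) →
              (∀ {x y} → Inv x → y ◁ x → Inv y × μ y ⊏ μ x) →
              ∀ x → Inv x → Acc _◁_ x
measure⇒acc {_◁_ = _◁_} {_⊏_} wf μ Inv decreases x inv = go x inv (wf (μ x))
  where
  go : ∀ x → Inv x → Acc _⊏_ (μ x) → Acc _◁_ x
  go x inv (acc rec) =
    acc λ y◁x → let (inv′ , lt) = decreases inv y◁x in go _ inv′ (rec lt)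

-- The multiset order on counting functions

_<ₘ_ : (ℕ → ℕ) → (ℕ → ℕ) → Set
c′ <ₘ c = ∃[ m ] c′ m < c m × (∀ k → m < k → c′ k ≤ c k)

+-mono-<ₘ-≤ : ∀ {c c′ d d′ : ℕ → ℕ} → c′ <ₘ c → (∀ k → d′ k ≤ d k) →
              (λ k → c′ k + d′ k) <ₘ (λ k → c k + d k)
+-mono-<ₘ-≤ (m , lt , le) d′≤d =
  m , +-mono-<-≤ lt (d′≤d m) , λ k m<k → +-mono-≤ (le k m<k) (d′≤d k)

+-mono-≤-<ₘ : ∀ {c c′ d d′ : ℕ → ℕ} → (∀ k → d′ k ≤ d k) → c′ <ₘ c →
              (λ k → d′ k + c′ k) <ₘ (λ k → d k + c k)
+-mono-≤-<ₘ d′≤d (m , lt , le) =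
  m , +-mono-≤-< (d′≤d m) lt , λ k m<k → +-mono-≤ (d′≤d k) (le k m<k)

weights : (n : ℕ) → (ℕ → ℕ) → ℕ → Vec ℕ (suc n)
weights zero    c r = r ∷ []
weights (suc n) c r = c n ∷ weights n c r

-- Comparing earlier entries by ≤ rather than = keeps the order well founded and
-- turns a decrease in the multiset order into a lexicographic one.
_<ₗ_ : ∀ {n} → Vec ℕ n → Vec ℕ n → Set
_<ₗ_ = Lex-< _≤_ _<_

<ₗ-wellFounded : ∀ {n} → WellFounded (_<ₗ_ {n})
<ₗ-wellFounded = Lex.<-wellFounded ≤-trans (λ y≤z x<y → <-≤-trans x<y y≤z) <-wellFounded

weights-<ₘ : ∀ n {c c′ r r′} → (∀ k → n ≤ k → c k ≡ 0) → c′ <ₘ c →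
             weights n c′ r′ <ₗ weights n c r
weights-<ₘ n {c} {c′} {r} {r′} vanish (m , c′m<cm , above) = go n m<n
  where
  m<n : m < n
  m<n = ≰⇒> λ n≤m → n≮0 (subst (c′ m <_) (vanish m n≤m) c′m<cm)

  go : ∀ n → m < n → weights n c′ r′ <ₗ weights n c r
  go (suc n) m<1+n with m<1+n⇒m<n∨m≡n m<1+n
  ... | inj₁ m<n  = next (above n m<n) (go n m<n)
  ... | inj₂ refl = this c′m<cm refl

weights-≤ : ∀ n {c c′ r r′} → (∀ k → c′ k ≤ c k) → r′ < r →
            weights n c′ r′ <ₗ weights n c r
weights-≤ zero    c′≤c r′<r = this r′<r refl
weights-≤ (suc n) c′≤c r′<r = next (c′≤c n) (weights-≤ n c′≤c r′<r)

_⊆⁺_ : List Lit → List Lit → Set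
xs ⊆⁺ ys = ∀ {p ts} → lit true p ts ∈ xs → lit true p ts ∈ ys

xs⊆⁺x∷xs : ∀ {x xs} → xs ⊆⁺ (x ∷ xs)
xs⊆⁺x∷xs = there

∷-mono-⊆⁺ : ∀ {x xs ys} → xs ⊆⁺ ys → (x ∷ xs) ⊆⁺ (x ∷ ys)
∷-mono-⊆⁺ xs⊆ys (here eq) = here eq
∷-mono-⊆⁺ xs⊆ys (there i) = there (xs⊆ys i)

x∈xs⇒x∷xs⊆⁺xs : ∀ {x xs} → x ∈ xs → (x ∷ xs) ⊆⁺ xs
x∈xs⇒x∷xs⊆⁺xs x∈xs (here refl) = x∈xs
x∈xs⇒x∷xs⊆⁺xs x∈xs (there i)   = i

neg∷xs⊆⁺xs : ∀ {p ts xs} → (lit false p ts ∷ xs) ⊆⁺ xs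
neg∷xs⊆⁺xs (there i) = i

absent : List Lit → Lit → ℕ
absent anc (lit false _ _) = 0
absent anc (lit true p ts) with lit true p ts ∈? anc
... | yes _ = 0
... | no _  = 1

absentAmong : List Lit → List Lit → ℕ
absentAmong anc []       = 0
absentAmong anc (u ∷ us) = absent anc u + absentAmong anc us

absent-≤-1 : ∀ anc u → absent anc u ≤ 1
absent-≤-1 anc (lit false _ _) = z≤n
absent-≤-1 anc (lit true p ts) with lit true p ts ∈? anc
... | yes _ = z≤n
... | no _  = ≤-refl

absent-anti : ∀ {xs ys} → xs ⊆⁺ ys → ∀ u → absent ys u ≤ absent xs u
absent-anti xs⊆ys (lit false _ _) = z≤n
absent-anti {xs} {ys} xs⊆ys (lit true p ts) with lit true p ts ∈? ys | lit true p ts ∈? xs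
... | yes _   | _       = z≤n
... | no ∉ys  | yes ∈xs = ⊥-elim (∉ys (xs⊆ys ∈xs))
... | no _    | no _    = ≤-refl

absentAmong-≤-length : ∀ anc us → absentAmong anc us ≤ length us
absentAmong-≤-length anc []       = z≤n
absentAmong-≤-length anc (u ∷ us) = +-mono-≤ (absent-≤-1 anc u) (absentAmong-≤-length anc us)

absentAmong-anti : ∀ {xs ys} → xs ⊆⁺ ys → ∀ us → absentAmong ys us ≤ absentAmong xs us
absentAmong-anti xs⊆ys []       = z≤n
absentAmong-anti xs⊆ys (u ∷ us) = +-mono-≤ (absent-anti xs⊆ys u) (absentAmong-anti xs⊆ys us)

absentAmong-strict : ∀ {xs ys p ts us} → xs ⊆⁺ ys → lit true p ts ∈ us →
                     lit true p ts ∈ ys → lit true p ts ∉ xs →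
                     absentAmong ys us < absentAmong xs us
absentAmong-strict {xs} {ys} {p} {ts} {_ ∷ us} xs⊆ys (here refl) ∈ys ∉xs
  with lit true p ts ∈? ys | lit true p ts ∈? xs
... | yes _  | no _    = s≤s (absentAmong-anti xs⊆ys us)
... | no ∉ys | _       = ⊥-elim (∉ys ∈ys)
... | yes _  | yes ∈xs = ⊥-elim (∉xs ∈xs)
absentAmong-strict {us = u ∷ us} xs⊆ys (there i) ∈ys ∉xs =
  +-mono-≤-< (absent-anti xs⊆ys u) (absentAmong-strict xs⊆ys i ∈ys ∉xs)

mutual
  flatten : Forest → List Lit
  flatten []       = []
  flatten (t ∷ ts) = flattenTree t ++ flatten ts

  flattenTree : Tree → List Lit
  flattenTree (node l cs) = l ∷ flatten cs

mutual
  size : Forest → ℕ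
  size []       = 0
  size (t ∷ ts) = treeSize t + size ts

  treeSize : Tree → ℕ
  treeSize (node l cs) = suc (size cs)

size-∈ : ∀ {l cs f} → node l cs ∈ f → size cs < size f
size-∈ {f = node _ _ ∷ ts} (here refl) = s≤s (m≤m+n _ (size ts))
size-∈ {f = t ∷ ts}        (there i)   = ≤-trans (size-∈ i) (m≤n+m _ (treeSize t))

mutual
  size-simp : ∀ {anc f f′} → SimpStep anc f f′ → size f′ < size f
  size-simp (lift i _)  = size-∈ i
  size-simp (inside st) = size-atOne st

  size-atOne : ∀ {anc f f′} → AtOne (TreeStep anc) f f′ → size f′ < size f
  size-atOne (here st)          = +-mono-<-≤ (size-tree st) ≤-refl
  size-atOne (there {t = t} st) = +-mono-≤-< (≤-refl {treeSize t}) (size-atOne st)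

  size-tree : ∀ {anc t t′} → TreeStep anc t t′ → treeSize t′ < treeSize t
  size-tree (cut {c = node _ _} _) = s≤s (s≤s z≤n)
  size-tree (deeper st)            = s≤s (size-simp st)

leafClosing-∈ : ∀ {anc l cs f} → node l cs ∈ f → LeafClosingF anc f →
                complement l ∈ anc → cs ≡ []
leafClosing-∈ (here refl) (closing , _) = closing
leafClosing-∈ {f = node _ _ ∷ _} (there i) (_ , _ , lc) = leafClosing-∈ i lc

LeftmostSplit : Forest → Forest × Lit × Forest × Forest → Set
LeftmostSplit cs (pre , l , ds , post) =
  cs ≡ pre ++ node l ds ∷ post × innerNeg (node l ds) ≡ true

leftmost-split : ∀ cs → Maybe.All (LeftmostSplit cs) (leftmost cs)
leftmost-split [] = Maybe.nothing
leftmost-split (node l ds ∷ ts) with innerNeg (node l ds) in inner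
... | true  = Maybe.just (refl , inner)
... | false with leftmost ts | leftmost-split ts
...   | nothing | _ = Maybe.nothing
...   | just _  | Maybe.just (split , inner′) =
        Maybe.just (cong (node l ds ∷_) split , inner′)

eqIndicator : ℕ → ℕ → ℕ
eqIndicator m n with m ≟ n
... | yes _ = 1
... | no _  = 0

eqIndicator-≢ : ∀ {m n} → m ≢ n → eqIndicator m n ≡ 0
eqIndicator-≢ {m} {n} m≢n with m ≟ n
... | yes m≡n = ⊥-elim (m≢n m≡n)
... | no _    = refl

eqIndicator-refl : ∀ n → eqIndicator n n ≡ 1
eqIndicator-refl n with n ≟ n
... | yes _  = refl
... | no n≢n = ⊥-elim (n≢n refl)

innerNegAt : ℕ → ℕ → Tree → ℕ
innerNegAt k v (node (lit false _ _) (_ ∷ _)) = eqIndicator v k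
innerNegAt k v (node _ _)                     = 0

innerNegAt-≢ : ∀ {k v} t → v ≢ k → innerNegAt k v t ≡ 0
innerNegAt-≢ (node (lit false _ _) (_ ∷ _)) v≢k = eqIndicator-≢ v≢k
innerNegAt-≢ (node (lit false _ _) [])      _   = refl
innerNegAt-≢ (node (lit true _ _) _)        _   = refl

innerNegAt-∷ : ∀ {k v} l {c c′ cs cs′} →
               innerNegAt k v (node l (c′ ∷ cs′)) ≡ innerNegAt k v (node l (c ∷ cs))
innerNegAt-∷ (lit true _ _)  = refl
innerNegAt-∷ (lit false _ _) = refl

innerNegAt-children : ∀ {k v} l {c cs} cs′ →
                      innerNegAt k v (node l cs′) ≤ innerNegAt k v (node l (c ∷ cs))
innerNegAt-children (lit true _ _)  _       = z≤n
innerNegAt-children (lit false _ _) []      = z≤n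
innerNegAt-children (lit false _ _) (_ ∷ _) = ≤-refl

-- Levels, for tableaux whose literals come from a fixed pool

module Termination (pool : List Lit) where

  maxLevel : ℕ
  maxLevel = length (map complement pool)

  level : List Lit → ℕ
  level anc = absentAmong anc (map complement pool)

  level-anti : ∀ {xs ys} → xs ⊆⁺ ys → level ys ≤ level xs
  level-anti xs⊆ys = absentAmong-anti xs⊆ys (map complement pool)

  level-cong : ∀ {xs ys} → xs ⊆⁺ ys → ys ⊆⁺ xs → level xs ≡ level ys
  level-cong xs⊆ys ys⊆xs = ≤-antisym (level-anti ys⊆xs) (level-anti xs⊆ys)

  -- A node's level is taken from the branch strictly above it, excluding its own literal.
  mutual
    count : ℕ → List Lit → Forest → ℕ
    count k anc []       = 0
    count k anc (t ∷ ts) = treeCount k anc t + count k anc ts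

    treeCount : ℕ → List Lit → Tree → ℕ
    treeCount k anc t@(node l cs) = innerNegAt k (level anc) t + count k (l ∷ anc) cs

  mutual
    count-cong : ∀ {k xs ys} → xs ⊆⁺ ys → ys ⊆⁺ xs → ∀ f → count k xs f ≡ count k ys f
    count-cong xs⊆ys ys⊆xs []       = refl
    count-cong xs⊆ys ys⊆xs (t ∷ ts) =
      cong₂ _+_ (treeCount-cong xs⊆ys ys⊆xs t) (count-cong xs⊆ys ys⊆xs ts)

    treeCount-cong : ∀ {k xs ys} → xs ⊆⁺ ys → ys ⊆⁺ xs → ∀ t →
                     treeCount k xs t ≡ treeCount k ys t
    treeCount-cong {k} xs⊆ys ys⊆xs t@(node l cs) =
      cong₂ _+_ (cong (λ v → innerNegAt k v t) (level-cong xs⊆ys ys⊆xs))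
                (count-cong (∷-mono-⊆⁺ xs⊆ys) (∷-mono-⊆⁺ ys⊆xs) cs)

  mutual
    count-above-level : ∀ {k anc} → level anc < k → ∀ f → count k anc f ≡ 0
    count-above-level lt []       = refl
    count-above-level lt (t ∷ ts) =
      cong₂ _+_ (treeCount-above-level lt t) (count-above-level lt ts)

    treeCount-above-level : ∀ {k anc} → level anc < k → ∀ t → treeCount k anc t ≡ 0
    treeCount-above-level lt t@(node l cs) =
      cong₂ _+_ (innerNegAt-≢ t (<⇒≢ lt))
                (count-above-level (≤-<-trans (level-anti xs⊆⁺x∷xs) lt) cs)

  count-vanishes : ∀ T k → suc maxLevel ≤ k → count k [] T ≡ 0
  count-vanishes T k le =
    count-above-level (<-≤-trans (s≤s (absentAmong-≤-length [] (map complement pool))) le) T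

  treeCount≤count : ∀ {k anc t f} → t ∈ f → treeCount k anc t ≤ count k anc f
  treeCount≤count (here refl) = m≤m+n _ _
  treeCount≤count {f = t ∷ ts} (there i) = ≤-trans (treeCount≤count i) (m≤n+m _ _)

  mutual
    LabelsIn : Forest → Set
    LabelsIn []       = ⊤
    LabelsIn (t ∷ ts) = TreeLabelsIn t × LabelsIn ts

    TreeLabelsIn : Tree → Set
    TreeLabelsIn (node l cs) = l ∈ pool × LabelsIn cs

  mutual
    ⊆⇒LabelsIn : ∀ f → flatten f ⊆ pool → LabelsIn f
    ⊆⇒LabelsIn []       _ = tt
    ⊆⇒LabelsIn (t ∷ ts) sub =
      ⊆⇒TreeLabelsIn t (sub ∘ xs⊆xs++ys _ _) , ⊆⇒LabelsIn ts (sub ∘ xs⊆ys++xs _ _)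

    ⊆⇒TreeLabelsIn : ∀ t → flattenTree t ⊆ pool → TreeLabelsIn t
    ⊆⇒TreeLabelsIn (node l cs) sub = sub (here refl) , ⊆⇒LabelsIn cs (sub ∘ there)

  LabelsIn-∈ : ∀ {t f} → t ∈ f → LabelsIn f → TreeLabelsIn t
  LabelsIn-∈ (here refl) (labels , _) = labels
  LabelsIn-∈ (there i)   (_ , labels) = LabelsIn-∈ i labels

  LabelsIn-prune : ∀ pre {l cs post} → LabelsIn (pre ++ node l cs ∷ post) →
                   LabelsIn (pre ++ node l [] ∷ post)
  LabelsIn-prune []        ((l∈ , _) , labels) = (l∈ , tt) , labels
  LabelsIn-prune (_ ∷ pre) (labels , labels′)  = labels , LabelsIn-prune pre labels′

  mutual
    LabelsIn-simp : ∀ {anc f f′} → SimpStep anc f f′ → LabelsIn f → LabelsIn f′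
    LabelsIn-simp (lift i _)  labels = proj₂ (LabelsIn-∈ i labels)
    LabelsIn-simp (inside st) labels = LabelsIn-atOne st labels

    LabelsIn-atOne : ∀ {anc f f′} → AtOne (TreeStep anc) f f′ → LabelsIn f → LabelsIn f′
    LabelsIn-atOne (here st)  (labels , labels′) = LabelsIn-tree st labels , labels′
    LabelsIn-atOne (there st) (labels , labels′) = labels , LabelsIn-atOne st labels′

    LabelsIn-tree : ∀ {anc t t′} → TreeStep anc t t′ → TreeLabelsIn t → TreeLabelsIn t′
    LabelsIn-tree (cut _)     (l∈ , _)      = l∈ , tt
    LabelsIn-tree (deeper st) (l∈ , labels) = l∈ , LabelsIn-simp st labels

  mutual
    count-simp : ∀ {anc f f′} → SimpStep anc f f′ → ∀ k → count k anc f′ ≤ count k anc f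
    count-simp {anc} {f} (lift {l = l} {cs} i l∈anc) k = begin
      count k anc cs                ≡⟨ count-cong xs⊆⁺x∷xs (x∈xs⇒x∷xs⊆⁺xs l∈anc) cs ⟩
      count k (l ∷ anc) cs          ≤⟨ m≤n+m _ _ ⟩
      treeCount k anc (node l cs)   ≤⟨ treeCount≤count i ⟩
      count k anc f                 ∎
      where open ≤-Reasoning
    count-simp (inside st) k = count-atOne st k

    count-atOne : ∀ {anc f f′} → AtOne (TreeStep anc) f f′ → ∀ k →
                  count k anc f′ ≤ count k anc f
    count-atOne (here st)  k = +-monoˡ-≤ _ (count-tree st k)
    count-atOne (there st) k = +-monoʳ-≤ _ (count-atOne st k)

    count-tree : ∀ {anc t t′} → TreeStep anc t t′ → ∀ k → treeCount k anc t′ ≤ treeCount k anc t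
    count-tree (cut {l} _) k = +-mono-≤ (innerNegAt-children l []) z≤n
    count-tree (deeper {cs = []} (lift () _))
    count-tree (deeper {cs = []} (inside ()))
    count-tree (deeper {l} {cs = _ ∷ _} {cs′} st) k =
      +-mono-≤ (innerNegAt-children l cs′) (count-simp st k)

  module _ (p : ℕ) (ts : List Term) (U : Forest) where

    mutual
      LabelsIn-attach : LabelsIn U → ∀ f → LabelsIn f → LabelsIn (attachF (lit true p ts) U f)
      LabelsIn-attach labelsU []       _                  = tt
      LabelsIn-attach labelsU (t ∷ ts) (labels , labels′) =
        TreeLabelsIn-attach labelsU t labels , LabelsIn-attach labelsU ts labels′

      TreeLabelsIn-attach : LabelsIn U → ∀ t → TreeLabelsIn t →
                            TreeLabelsIn (attach (lit true p ts) U t)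
      TreeLabelsIn-attach labelsU (node l []) (l∈ , _) with l ≟ᴸ lit true p ts
      ... | yes _ = l∈ , labelsU
      ... | no _  = l∈ , tt
      TreeLabelsIn-attach labelsU (node l (c ∷ cs)) (l∈ , labels) =
        l∈ , LabelsIn-attach labelsU (c ∷ cs) labels

    mutual
      count-attach : ∀ {k} anc f → level (lit true p ts ∷ anc) < k →
                     count k anc (attachF (lit true p ts) U f) ≡ count k anc f
      count-attach anc []       lt = refl
      count-attach anc (t ∷ f)  lt = cong₂ _+_ (treeCount-attach anc t lt) (count-attach anc f lt)

      treeCount-attach : ∀ {k} anc t → level (lit true p ts ∷ anc) < k →
                         treeCount k anc (attach (lit true p ts) U t) ≡ treeCount k anc t
      treeCount-attach anc (node l []) lt with l ≟ᴸ lit true p ts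
      ... | yes refl = count-above-level lt U
      ... | no _     = refl
      treeCount-attach anc (node l (c ∷ cs)) lt =
        cong₂ _+_ (innerNegAt-∷ l)
             (count-attach (l ∷ anc) (c ∷ cs)
                           (≤-<-trans (level-anti (∷-mono-⊆⁺ xs⊆⁺x∷xs)) lt))

  Decreases : List Lit → Forest → Forest → Set
  Decreases anc cs cs′ = (λ k → count k anc cs′) <ₘ (λ k → count k anc cs) × LabelsIn cs′

  attach-decreases :
    ∀ anc pre p ts d ds post →
    let N = node (lit false p ts) (d ∷ ds) in
    LeafClosingF anc (pre ++ N ∷ post) → LabelsIn (pre ++ N ∷ post) →
    Decreases anc (pre ++ N ∷ post)
              (attachF (lit true p ts) (pre ++ node (lit false p ts) [] ∷ post) (d ∷ ds))
  attach-decreases anc pre p ts d ds post lc labels =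
    (level anc , drops-at-level , above) ,
    LabelsIn-attach p ts U (LabelsIn-prune pre labels) D labelsD
    where
    N = node (lit false p ts) (d ∷ ds)
    D = d ∷ ds
    U = pre ++ node (lit false p ts) [] ∷ post
    N∈ : N ∈ pre ++ N ∷ post
    N∈ = ∈-insert pre
    labelsD = proj₂ (LabelsIn-∈ N∈ labels)

    new old : ℕ → ℕ
    new k = count k anc (attachF (lit true p ts) U D)
    old k = count k anc (pre ++ N ∷ post)

    level-drops : level (lit true p ts ∷ anc) < level anc
    level-drops =
      absentAmong-strict xs⊆⁺x∷xs (∈-map⁺ complement (proj₁ (LabelsIn-∈ N∈ labels)))
                         (here refl) λ a∈anc → case leafClosing-∈ N∈ lc a∈anc of λ ()

    new≡ : ∀ {k} → level anc ≤ k → new k ≡ count k anc D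
    new≡ le = count-attach p ts U anc D (<-≤-trans level-drops le)

    old≥ : ∀ k → innerNegAt k (level anc) N + count k anc D ≤ old k
    old≥ k = subst (λ x → innerNegAt k (level anc) N + x ≤ old k)
                   (count-cong neg∷xs⊆⁺xs xs⊆⁺x∷xs D) (treeCount≤count N∈)

    drops-at-level : new (level anc) < old (level anc)
    drops-at-level = begin-strict
      new v                             ≡⟨ new≡ ≤-refl ⟩
      count v anc D                     <⟨ n<1+n _ ⟩
      1 + count v anc D                 ≡⟨ cong (_+ count v anc D) (sym (eqIndicator-refl v)) ⟩
      innerNegAt v v N + count v anc D  ≤⟨ old≥ v ⟩
      old v                             ∎
      where open ≤-Reasoning
            v = level anc

    above : ∀ k → level anc < k → new k ≤ old k
    above k lt = begin
      new k                                       ≡⟨ new≡ (<⇒≤ lt) ⟩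
      count k anc D                               ≤⟨ m≤n+m _ (innerNegAt k (level anc) N) ⟩
      innerNegAt k (level anc) N + count k anc D  ≤⟨ old≥ k ⟩
      old k                                       ∎
      where open ≤-Reasoning

  hyperAt-decreases : ∀ anc cs → LeafClosingF anc cs → LabelsIn cs →
                      Maybe.All (Decreases anc cs) (hyperAt cs)
  hyperAt-decreases anc cs lc labels with leftmost cs | leftmost-split cs
  ... | nothing | _ = Maybe.nothing
  ... | just (_ , lit true _ _ , _ ∷ _ , _)          | Maybe.just (_ , ())
  ... | just (_ , lit false _ _ , [] , _)            | Maybe.just (_ , ())
  ... | just (pre , lit false p ts , d ∷ ds , post)  | Maybe.just (refl , _) =
        Maybe.just (attach-decreases anc pre p ts d ds post lc labels)

  mutual
    search-decreases : ∀ anc cs → LeafClosingF anc cs → LabelsIn cs →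
                       Maybe.All (Decreases anc cs) (search cs)
    search-decreases anc cs lc labels with hyperAt cs | hyperAt-decreases anc cs lc labels
    ... | just _  | Maybe.just dec = Maybe.just dec
    ... | nothing | _              = searchKids-decreases anc cs lc labels

    searchKids-decreases : ∀ anc cs → LeafClosingF anc cs → LabelsIn cs →
                           Maybe.All (Decreases anc cs) (searchKids cs)
    searchKids-decreases anc [] _ _ = Maybe.nothing
    searchKids-decreases anc (node l [] ∷ ts) (_ , _ , lcts) (labels , labelsts)
      with searchKids ts | searchKids-decreases anc ts lcts labelsts
    ... | just _  | Maybe.just (dec , labels′) =
          Maybe.just (+-mono-≤-<ₘ (λ _ → ≤-refl) dec , labels , labels′)
    ... | nothing | _ = Maybe.nothing
    searchKids-decreases anc (node l (d ∷ ds) ∷ ts) (_ , lcds , lcts) ((l∈ , labelsds) , labelsts)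
      with search (d ∷ ds) | search-decreases (l ∷ anc) (d ∷ ds) lcds labelsds
    ... | just _  | Maybe.just (dec , labels′) =
          Maybe.just ( +-mono-<ₘ-≤ (+-mono-≤-<ₘ (λ _ → innerNegAt-children l _) dec) (λ _ → ≤-refl)
                     , (l∈ , labels′) , labelsts)
    ... | nothing | _ with searchKids ts | searchKids-decreases anc ts lcts labelsts
    ...   | just _  | Maybe.just (dec , labels′) =
            Maybe.just (+-mono-≤-<ₘ (λ _ → ≤-refl) dec , (l∈ , labelsds) , labels′)
    ...   | nothing | _ = Maybe.nothing

  Invariant : State → Set
  Invariant (simplifying T) = LabelsIn T
  Invariant (looping T)     = LabelsIn T × LeafClosing T

  measure : State → Vec ℕ (suc (suc maxLevel))
  measure (simplifying T) = weights (suc maxLevel) (λ k → count k [] T) (suc (size T))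
  measure (looping T)     = weights (suc maxLevel) (λ k → count k [] T) 0

  step-decreases : ∀ {s s′} → Invariant s → Step s s′ → Invariant s′ × measure s′ <ₗ measure s
  step-decreases labels (simp st) =
    LabelsIn-simp st labels , weights-≤ _ (count-simp st) (s≤s (size-simp st))
  step-decreases labels (simpDone lc _) = (labels , lc) , weights-≤ _ (λ _ → ≤-refl) z<s
  step-decreases (labels , lc) (hyper {T} e) =
    let (dec , labels′) = Maybe.drop-just (subst (Maybe.All _) e (search-decreases [] T lc labels))
    in labels′ , weights-<ₘ _ (count-vanishes T) dec

  terminates : ∀ T → LabelsIn T → Terminates (simplifying T)
  terminates T = measure⇒acc <ₗ-wellFounded measure Invariant step-decreases (simplifying T)

proposition6 : (F : Formula) (T : Tableau) →
    IsClausalTableauFor F T → Closed T → Terminates (simplifying T)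
proposition6 F T _ _ =
  Termination.terminates (flatten T) T (Termination.⊆⇒LabelsIn (flatten T) T id)
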